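{- Let $\mathcal{A}$ be a finite unary structure over the signature $\{M_1,\dots,M_n\}$, let $\mathcal{A}'$ be the core of $\mathcal{A}$, and let $\forall y\, w_\forall(y)$ be the canonical universal sentence of $\mathcal{A}$. Then the Q-core of $\mathcal{A}$ is the unique (up to isomorphism) substructure of $\mathcal{A}$ described as follows: it is $\mathcal{A}'$ if $\mathcal{A}$ and $\mathcal{A}'$ have the same canonical universal sentence, and otherwise it is the disjoint union of $\mathcal{A}'$ with a single element corresponding to $w_\forall$ (i.e. an element lying in $M_i$ exactly when $w_\forall[i]=1$).
   Context: A unary structure is a structure over a signature of $n$ unary relation symbols $M_1,\dots,M_n$. For a word $w\in\{0,1\}^n$, $w(x)$ abbreviates $\bigwedge_{1\le i\le n,\,w[i]=1}M_i(x)$. Each element $a$ of a unary structure corresponds to the word $w$ with $w[i]=1$ iff $a\in M_i$. For a unary structure $\mathcal{C}$, $w_\forall$ is the bitwise conjunction of the words of all its elements, and $\forall y\,w_\forall(y)$ is its canonical universal sentence. $\{\exists,\wedge\}$-FO (primitive positive) and $\{\exists,\forall,\wedge\}$-FO (positive Horn) sentences are built from relational atoms (no equality, no negation) using $\exists,\wedge$ and $\exists,\forall,\wedge$ respectively. A substructure of $\mathcal{A}$ is $\mathcal{C}$ with $C\subseteq A$ and $R^{\mathcal{C}}\subseteq R^{\mathcal{A}}$ (not necessarily induced). The core of $\mathcal{A}$ is a minimal substructure of $\mathcal{A}$ satisfying exactly the same $\{\exists,\wedge\}$-FO sentences as $\mathcal{A}$ (it is unique up to isomorphism and induced). A Q-core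 of $\mathcal{A}$ is a minimal substructure of $\mathcal{A}$ satisfying exactly the same $\{\exists,\forall,\wedge\}$-FO sentences as $\mathcal{A}$. -}

module Defs where

open import Data.Nat using (ℕ; zero; suc)
open import Data.Fin using (Fin; zero; suc)
open import Data.Bool using (Bool; true; false)
open import Data.List using (allFin)
import Data.List as List
open import Data.Bool.ListAction using (and)
open import Data.Product using (Σ; _×_; _,_)
open import Function.Bundles using (_↔_; Inverse)
open import Function.Definitions using (Injective)
open import Relation.Binary.PropositionalEquality using (_≡_)

-- A unary structure over the signature {M_1,...,M_n} (indexed by Fin n).
-- Domains are finite and non-empty: the domain is Fin (suc card).
-- Membership a ∈ M_i is  rel i a ≡ true.
record Str (n : ℕ) : Set where
  field
    card : ℕ
    rel  : Fin n → Fin (suc card) → Bool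

open Str public

Dom : ∀ {n} → Str n → Set
Dom S = Fin (suc (card S))

-- Formulas built from relational atoms with ∧, ∃ and (only if q ≡ true) ∀.
-- k = number of free variables (de Bruijn).
-- Fml false 0 = {∃,∧}-FO sentences,  Fml true 0 = {∃,∀,∧}-FO sentences.
data Fml (n : ℕ) : Bool → ℕ → Set where
  atom : ∀ {q k} → Fin n → Fin k → Fml n q k
  _∧_  : ∀ {q k} → Fml n q k → Fml n q k → Fml n q k
  ex   : ∀ {q k} → Fml n q (suc k) → Fml n q k
  all  : ∀ {k} → Fml n true (suc k) → Fml n true k

extendEnv : ∀ {A : Set} {k} → (Fin k → A) → A → Fin (suc k) → A
extendEnv ρ a zero    = a
extendEnv ρ a (suc x) = ρ x

Sat : ∀ {n q k} (S : Str n) → Fml n q k → (Fin k → Dom S) → Set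
Sat S (atom i x) ρ = rel S i (ρ x) ≡ true
Sat S (φ ∧ ψ)    ρ = Sat S φ ρ × Sat S ψ ρ
Sat S (ex φ)     ρ = Σ (Dom S) λ a → Sat S φ (extendEnv ρ a)
Sat S (all φ)    ρ = (a : Dom S) → Sat S φ (extendEnv ρ a)

noEnv : ∀ {A : Set} → Fin 0 → A
noEnv ()

SameTheory : ∀ {n} → Bool → Str n → Str n → Set
SameTheory {n} q S T =
  (φ : Fml n q 0) → (Sat S φ noEnv → Sat T φ noEnv) × (Sat T φ noEnv → Sat S φ noEnv)

-- C is a (not necessarily induced) substructure of A, presented by an
-- injective map of domains along which every relation of C is contained in A's.
Sub : ∀ {n} → Str n → Str n → Set
Sub {n} C A =
  Σ (Dom C → Dom A) λ ι → Injective _≡_ _≡_ ι ×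
    ((i : Fin n) (c : Dom C) → rel C i c ≡ true → rel A i (ι c) ≡ true)

-- The substructure embedding is the whole of C (bijective on domains and
-- reflecting every relation), i.e. not a proper substructure.
IsFull : ∀ {n} {C A : Str n} → Sub C A → Set
IsFull {n} {C} {A} (ι , _ , _) =
  ((a : Dom A) → Σ (Dom C) λ c → ι c ≡ a) ×
  ((i : Fin n) (c : Dom C) → rel A i (ι c) ≡ true → rel C i c ≡ true)

IsMinimalSame : ∀ {n} → Bool → (A C : Str n) → Sub C A → Set
IsMinimalSame {n} q A C e =
  SameTheory q A C ×
  ((D : Str n) (d : Sub D C) → SameTheory q A D → IsFull {n} {D} {C} d)

IsCore : ∀ {n} (A C : Str n) → Sub C A → Set
IsCore = IsMinimalSame false

IsQCore : ∀ {n} (A C : Str n) → Sub C A → Set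
IsQCore = IsMinimalSame true

Iso : ∀ {n} → Str n → Str n → Set
Iso {n} C D =
  Σ (Dom C ↔ Dom D) λ f → (i : Fin n) (c : Dom C) → rel C i c ≡ rel D i (Inverse.to f c)

wAll : ∀ {n} → Str n → Fin n → Bool
wAll S i = and (List.map (rel S i) (allFin (suc (card S))))

addElem : ∀ {n} → Str n → (Fin n → Bool) → Str n
addElem C w = record { card = suc (card C) ; rel = r }
  where
    r : _ → _ → Bool
    r i zero    = w i
    r i (suc c) = rel C i c

QCoreIs : ∀ {n} → Str n → Str n → Set
QCoreIs {n} A B =
  (Σ (Str n) λ Q → Σ (Sub Q A) λ e → IsQCore A Q e × Iso Q B) ×
  ((Q : Str n) (e : Sub Q A) → IsQCore A Q e → Iso Q B)

-- Positive formulas over a unary signature only see the words of points, and the set of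
-- word assignments satisfying one is closed upwards and, since there is no disjunction,
-- under meets. Hence a {∃,∧}-sentence true in S stays true in T as soon as every point of
-- S is dominated by a point of T, and a {∃,∀,∧}-sentence does too if moreover
-- w_∀(S) ≤ w_∀(T): a universally quantified variable can be instantiated by the meet of
-- all words of S. Conversely the sentences ∃x w(x) and ∀x M_i(x) detect these conditions.
-- The core A' is therefore an antichain of words covering A, and w_∀(A) ≤ w_∀(A'). If the
-- two are equal A' already has the positive Horn theory of A; otherwise exactly one extra
-- point, carrying w_∀(A), is needed. In both cases the candidate embeds into every
-- structure with the theory of A, and minimality of a Q-core makes that embedding onto.

module Submission where

open import Defs
open import Data.Nat using (ℕ)
open import Data.Fin using (Fin)
open import Data.Product using (_×_)
open import Relation.Nullary using (¬_)
open import Relation.Binary.PropositionalEquality using (_≡_)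

import Data.Nat as ℕ
open import Data.Bool using (Bool; true; false) renaming (_∧_ to _∧ᵇ_; _≟_ to _≟ᵇ_)
open import Data.Bool.ListAction using (and)
open import Data.Bool.Properties using (∧-conicalˡ; T-≡; ⇔→≡)
open import Data.Empty using (⊥-elim)
open import Data.Fin using (zero; suc; punchIn; punchOut) renaming (_≟_ to _≟ᶠ_)
open import Data.Fin.Properties
  using (any?; ¬∀⟶∃¬; punchIn-injective; punchInᵢ≢i; punchIn-punchOut)
open import Data.List using (List; []; _∷_; allFin; filter; tabulate)
import Data.List as List
open import Data.List.Membership.Propositional using (_∈_)
open import Data.List.Membership.Propositional.Properties using (∈-allFin; ∈-filter⁺)
open import Data.List.Relation.Unary.All as All using (All; []; _∷_)
open import Data.List.Relation.Unary.All.Properties using (all⁻; all⁺; all-filter)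
open import Data.List.Relation.Unary.Any.Properties using (¬Any[])
open import Data.Product using (Σ; _,_; proj₁; proj₂)
open import Function using (_∘_)
open import Function.Bundles using (Equivalence; mk⇔; mk↔ₛ′)
open import Function.Construct.Identity using (↔-id)
open import Function.Definitions using (Injective)
open import Relation.Binary.PropositionalEquality using (refl; sym; trans; cong; cong₂; subst)
open import Relation.Nullary using (Dec; yes; no)
open import Relation.Unary using (Decidable)

module _ {n : ℕ} where

  Word : Set
  Word = Fin n → Bool

  infix 4 _≤w_

  _≤w_ : Word → Word → Set
  v ≤w w = ∀ i → v i ≡ true → w i ≡ true

  ≤w-refl : {w : Word} → w ≤w w
  ≤w-refl i h = h

  ≤w-trans : {u v w : Word} → u ≤w v → v ≤w w → u ≤w w
  ≤w-trans u≤v v≤w i = v≤w i ∘ u≤v i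

  ≤w-antisym : {v w : Word} → v ≤w w → w ≤w v → ∀ i → v i ≡ w i
  ≤w-antisym v≤w w≤v i = ⇔→≡ (mk⇔ (v≤w i) (w≤v i))

  _⊓_ : Word → Word → Word
  (v ⊓ w) i = v i ∧ᵇ w i

  ⊓-lowerˡ : {v w : Word} → v ⊓ w ≤w v
  ⊓-lowerˡ {v} {w} i = ∧-conicalˡ (v i) (w i)

  word : (S : Str n) → Dom S → Word
  word S a i = rel S i a

  wAll≤word : (S : Str n) (a : Dom S) → wAll S ≤w word S a
  wAll≤word S a i h =
    Equivalence.to T-≡ (All.lookup (all⁺ (rel S i) _ (Equivalence.from T-≡ h)) (∈-allFin a))

  wAll-intro : (S : Str n) (i : Fin n) → (∀ a → rel S i a ≡ true) → wAll S i ≡ true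
  wAll-intro S i h =
    Equivalence.to T-≡ (all⁻ (rel S i) (All.universal (Equivalence.from T-≡ ∘ h) (allFin _)))

  ≤wAll : (S : Str n) {v : Word} → (∀ a → v ≤w word S a) → v ≤w wAll S
  ≤wAll S v≤ i h = wAll-intro S i (λ a → v≤ a i h)

  Covers : Str n → Str n → Set
  Covers S T = (a : Dom S) → Σ (Dom T) λ b → word S a ≤w word T b

  covers-trans : {S T U : Str n} → Covers S T → Covers T U → Covers S U
  covers-trans f g a =
    let (b , a≤b) = f a
        (c , b≤c) = g b
    in c , ≤w-trans a≤b b≤c

  sub⇒covers : {C T : Str n} → Sub C T → Covers C T
  sub⇒covers (ι , _ , hom) c = ι c , λ i → hom i c

  Env : ℕ → Set
  Env k = Fin k → Word

  infix 4 _≤ₑ_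

  _≤ₑ_ : ∀ {k} → Env k → Env k → Set
  ρ ≤ₑ σ = ∀ x → ρ x ≤w σ x

  ≤ₑ-trans : ∀ {k} {ρ σ τ : Env k} → ρ ≤ₑ σ → σ ≤ₑ τ → ρ ≤ₑ τ
  ≤ₑ-trans ρ≤σ σ≤τ x = ≤w-trans (ρ≤σ x) (σ≤τ x)

  _⊓ₑ_ : ∀ {k} → Env k → Env k → Env k
  (ρ ⊓ₑ σ) x = ρ x ⊓ σ x

  extendEnv-mono : ∀ {k} {ρ σ : Env k} {v w : Word} →
    ρ ≤ₑ σ → v ≤w w → extendEnv ρ v ≤ₑ extendEnv σ w
  extendEnv-mono ρ≤σ v≤w zero    = v≤w
  extendEnv-mono ρ≤σ v≤w (suc x) = ρ≤σ x

  extendEnv-⊓ : ∀ {k} {ρ σ : Env k} {v w : Word} →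
    extendEnv ρ v ⊓ₑ extendEnv σ w ≤ₑ extendEnv (ρ ⊓ₑ σ) (v ⊓ w)
  extendEnv-⊓ zero    = ≤w-refl
  extendEnv-⊓ (suc x) = ≤w-refl

  SatW : ∀ {q k} (S : Str n) → Fml n q k → Env k → Set
  SatW S (atom i x) ρ = ρ x i ≡ true
  SatW S (φ ∧ ψ)    ρ = SatW S φ ρ × SatW S ψ ρ
  SatW S (ex φ)     ρ = Σ (Dom S) λ a → SatW S φ (extendEnv ρ (word S a))
  SatW S (all φ)    ρ = (a : Dom S) → SatW S φ (extendEnv ρ (word S a))

  satW-mono : ∀ {q k} (S : Str n) (φ : Fml n q k) {ρ σ : Env k} →
    ρ ≤ₑ σ → SatW S φ ρ → SatW S φ σ
  satW-mono S (atom i x) ρ≤σ s       = ρ≤σ x i s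
  satW-mono S (φ ∧ ψ)    ρ≤σ (s , t) = satW-mono S φ ρ≤σ s , satW-mono S ψ ρ≤σ t
  satW-mono S (ex φ)     ρ≤σ (a , s) = a , satW-mono S φ (extendEnv-mono ρ≤σ ≤w-refl) s
  satW-mono S (all φ)    ρ≤σ s a     = satW-mono S φ (extendEnv-mono ρ≤σ ≤w-refl) (s a)

  sat⇒satW : ∀ {q k} (S : Str n) (φ : Fml n q k) {ρ : Fin k → Dom S} {σ : Env k} →
    (∀ x → word S (ρ x) ≤w σ x) → Sat S φ ρ → SatW S φ σ
  sat⇒satW S (atom i x) ρ≤σ s       = ρ≤σ x i s
  sat⇒satW S (φ ∧ ψ)    ρ≤σ (s , t) = sat⇒satW S φ ρ≤σ s , sat⇒satW S ψ ρ≤σ t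
  sat⇒satW S (ex φ)     ρ≤σ (a , s) =
    a , sat⇒satW S φ (λ { zero → ≤w-refl ; (suc x) → ρ≤σ x }) s
  sat⇒satW S (all φ)    ρ≤σ s a     =
    sat⇒satW S φ (λ { zero → ≤w-refl ; (suc x) → ρ≤σ x }) (s a)

  satW⇒sat : ∀ {q k} (S : Str n) (φ : Fml n q k) {ρ : Fin k → Dom S} {σ : Env k} →
    (∀ x → σ x ≤w word S (ρ x)) → SatW S φ σ → Sat S φ ρ
  satW⇒sat S (atom i x) σ≤ρ s       = σ≤ρ x i s
  satW⇒sat S (φ ∧ ψ)    σ≤ρ (s , t) = satW⇒sat S φ σ≤ρ s , satW⇒sat S ψ σ≤ρ t
  satW⇒sat S (ex φ)     σ≤ρ (a , s) =
    a , satW⇒sat S φ (λ { zero → ≤w-refl ; (suc x) → σ≤ρ x }) s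
  satW⇒sat S (all φ)    σ≤ρ s a     =
    satW⇒sat S φ (λ { zero → ≤w-refl ; (suc x) → σ≤ρ x }) (s a)

  satW-⊓ : ∀ {q k} (S : Str n) (φ : Fml n q k) {ρ σ : Env k} →
    SatW S φ ρ → SatW S φ σ → SatW S φ (ρ ⊓ₑ σ)
  satW-⊓ S (atom i x) s        t        = cong₂ _∧ᵇ_ s t
  satW-⊓ S (φ ∧ ψ)    (s , s') (t , t') = satW-⊓ S φ s t , satW-⊓ S ψ s' t'
  satW-⊓ S (ex φ)     (a , s)  (b , t)  =
    a , satW-mono S φ (≤ₑ-trans extendEnv-⊓ (extendEnv-mono (λ _ → ≤w-refl) ⊓-lowerˡ))
          (satW-⊓ S φ s t)
  satW-⊓ S (all φ)    s        t      a =
    satW-mono S φ (≤ₑ-trans extendEnv-⊓ (extendEnv-mono (λ _ → ≤w-refl) ⊓-lowerˡ))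
      (satW-⊓ S φ (s a) (t a))

  meetOf : (S : Str n) → List (Dom S) → Word
  meetOf S as i = and (List.map (rel S i) as)

  satW-meetOf : ∀ {q k} (S : Str n) (φ : Fml n q (ℕ.suc k)) {ρ : Env k} →
    (∀ a → SatW S φ (extendEnv ρ (word S a))) →
    ∀ a as → SatW S φ (extendEnv ρ (meetOf S (a ∷ as)))
  satW-meetOf S φ s a []       =
    satW-mono S φ (extendEnv-mono (λ _ → ≤w-refl) (λ i h → cong₂ _∧ᵇ_ h refl)) (s a)
  satW-meetOf S φ s a (b ∷ bs) =
    satW-mono S φ (≤ₑ-trans extendEnv-⊓ (extendEnv-mono (λ _ → ⊓-lowerˡ) ≤w-refl))
      (satW-⊓ S φ (s a) (satW-meetOf S φ s b bs))

  satW-wAll : ∀ {q k} (S : Str n) (φ : Fml n q (ℕ.suc k)) {ρ : Env k} →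
    (∀ a → SatW S φ (extendEnv ρ (word S a))) → SatW S φ (extendEnv ρ (wAll S))
  satW-wAll S φ s = satW-meetOf S φ s zero (tabulate suc)

  satW-transfer : ∀ {q k} {S T : Str n} (φ : Fml n q k) {ρ : Env k} →
    Covers S T → (q ≡ true → wAll S ≤w wAll T) → SatW S φ ρ → SatW T φ ρ
  satW-transfer (atom i x) cover wAll≤ s       = s
  satW-transfer (φ ∧ ψ)    cover wAll≤ (s , t) =
    satW-transfer φ cover wAll≤ s , satW-transfer ψ cover wAll≤ t
  satW-transfer {T = T} (ex φ) cover wAll≤ (a , s) =
    let (b , a≤b) = cover a
    in b , satW-mono T φ (extendEnv-mono (λ _ → ≤w-refl) a≤b) (satW-transfer φ cover wAll≤ s)
  satW-transfer {S = S} {T} (all φ) cover wAll≤ s b =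
    satW-mono T φ (extendEnv-mono (λ _ → ≤w-refl) (≤w-trans (wAll≤ refl) (wAll≤word T b)))
      (satW-transfer φ cover wAll≤ (satW-wAll S φ s))

  transfer : ∀ {q} {S T : Str n} (φ : Fml n q 0) →
    Covers S T → (q ≡ true → wAll S ≤w wAll T) → Sat S φ noEnv → Sat T φ noEnv
  transfer {S = S} {T} φ cover wAll≤ =
    satW⇒sat T φ {σ = noEnv} (λ ()) ∘ satW-transfer φ cover wAll≤ ∘ sat⇒satW S φ (λ ())

  sameTheory-intro : ∀ {q} {S T : Str n} → Covers S T → Covers T S →
    (q ≡ true → wAll S ≤w wAll T) → (q ≡ true → wAll T ≤w wAll S) → SameTheory q S T
  sameTheory-intro S⊑T T⊑S wS≤wT wT≤wS φ = transfer φ S⊑T wS≤wT , transfer φ T⊑S wT≤wS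

  sameTheory-refl : ∀ {q} {S : Str n} → SameTheory q S S
  sameTheory-refl φ = (λ s → s) , (λ s → s)

  sameTheory-sym : ∀ {q} {S T : Str n} → SameTheory q S T → SameTheory q T S
  sameTheory-sym st φ = proj₂ (st φ) , proj₁ (st φ)

  atoms : ∀ {q} → Fin n → List (Fin n) → Fml n q 1
  atoms i []       = atom i zero
  atoms i (j ∷ js) = atom i zero ∧ atoms j js

  sat-atoms⁺ : ∀ {q} (S : Str n) {a : Dom S} i js →
    All (λ j → rel S j a ≡ true) (i ∷ js) → Sat S (atoms {q} i js) (extendEnv noEnv a)
  sat-atoms⁺ S i []       (h ∷ [])  = h
  sat-atoms⁺ S i (j ∷ js) (h ∷ hs) = h , sat-atoms⁺ S j js hs

  sat-atoms⁻ : ∀ {q} (S : Str n) {a : Dom S} i js →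
    Sat S (atoms {q} i js) (extendEnv noEnv a) → All (λ j → rel S j a ≡ true) (i ∷ js)
  sat-atoms⁻ S i []       h        = h ∷ []
  sat-atoms⁻ S i (j ∷ js) (h , hs) = h ∷ sat-atoms⁻ S j js hs

  -- The sentence ∃x ⋀_{i ∈ is} M_i(x) needs a letter; a point with the empty word is
  -- dominated by any point.
  coveringPoint : ∀ {q} {S T : Str n} → SameTheory q S T → (a : Dom S) (is : List (Fin n)) →
    All (λ j → rel S j a ≡ true) is → (∀ j → rel S j a ≡ true → j ∈ is) →
    Σ (Dom T) λ b → word S a ≤w word T b
  coveringPoint st a []       _     letters = zero , λ j h → ⊥-elim (¬Any[] (letters j h))
  coveringPoint {S = S} {T} st a (i ∷ is) holds letters =
    let (b , sat) = proj₁ (st (ex (atoms i is))) (a , sat-atoms⁺ S i is holds)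
    in b , λ j h → All.lookup (sat-atoms⁻ T i is sat) (letters j h)

  sameTheory⇒covers : ∀ {q} {S T : Str n} → SameTheory q S T → Covers S T
  sameTheory⇒covers {S = S} st a =
    coveringPoint st a (filter letter? (allFin n)) (all-filter letter? (allFin n))
      (λ j h → ∈-filter⁺ letter? (∈-allFin j) h)
    where
      letter? : Decidable λ j → rel S j a ≡ true
      letter? j = rel S j a ≟ᵇ true

  sameTheory⇒wAll≤ : {S T : Str n} → SameTheory true S T → wAll S ≤w wAll T
  sameTheory⇒wAll≤ {S} {T} st i h =
    wAll-intro T i (proj₁ (st (all (atom i zero))) (λ a → wAll≤word S a i h))

  Maximal : (S : Str n) → Dom S → Set
  Maximal S a = ∀ b → word S a ≤w word S b → b ≡ a

  Antichain : Str n → Set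
  Antichain S = ∀ a → Maximal S a

  antichain-cover≡id : {C : Str n} → Antichain C → (f : Covers C C) → ∀ c → proj₁ (f c) ≡ c
  antichain-cover≡id anti f c = anti c (proj₁ (f c)) (proj₂ (f c))

  antichain-embeds : {C T : Str n} → Antichain C → Covers C T → Covers T C → Sub C T
  antichain-embeds anti f g = proj₁ ∘ f , injective , λ i c → proj₂ (f c) i
    where
      retract : ∀ c → proj₁ (g (proj₁ (f c))) ≡ c
      retract = antichain-cover≡id anti (covers-trans f g)

      injective : Injective _≡_ _≡_ (proj₁ ∘ f)
      injective {x} {y} fx≡fy = trans (sym (retract x)) (trans (cong (proj₁ ∘ g) fx≡fy) (retract y))

  antichain-wAll≥ : {C T : Str n} → Antichain C → Covers C T → Covers T C → wAll T ≤w wAll C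
  antichain-wAll≥ {C} {T} anti f g = ≤wAll C λ c →
    subst (λ c′ → wAll T ≤w word C c′) (antichain-cover≡id anti (covers-trans f g) c)
      (≤w-trans (wAll≤word T (proj₁ (f c))) (proj₂ (g (proj₁ (f c)))))

  InImage : {X Y : Set} → (X → Y) → Y → Set
  InImage {X} f y = Σ X λ x → f x ≡ y

  missedPoint : ∀ {a b} (f : Fin a → Fin b) →
    ¬ (∀ y → InImage f y) → Σ (Fin b) λ y → ¬ InImage f y
  missedPoint f notOnto = ¬∀⟶∃¬ _ (InImage f) (λ y → any? λ x → f x ≟ᶠ y) notOnto

  onto-sub⇒wAll≤ : {C T : Str n} (ι : Sub C T) → (∀ t → InImage (proj₁ ι) t) → wAll C ≤w wAll T
  onto-sub⇒wAll≤ {C} {T} (ι , _ , hom) onto = ≤wAll T λ t →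
    let (c , ιc≡t) = onto t
    in subst (λ t′ → wAll C ≤w word T t′) ιc≡t (≤w-trans (wAll≤word C c) (λ i → hom i c))

  module _ {D B : Str n} (d : Sub D B) (cover : Covers B D) where

    maximal-inImage : ∀ {b} → Maximal B b → InImage (proj₁ d) b
    maximal-inImage {b} max =
      let (x , b≤x) = cover b
      in x , max (proj₁ d x) (≤w-trans b≤x (λ i → proj₂ (proj₂ d) i x))

    maximal-reflected : ∀ {b} → Maximal B b → ∀ x → proj₁ d x ≡ b → word B b ≤w word D x
    maximal-reflected {b} max x dx≡b =
      subst (λ y → word B b ≤w word D y)
        (proj₁ (proj₂ d) (trans (proj₂ (maximal-inImage max)) (sym dx≡b)))
        (proj₂ (cover b))

  antichain-full : {D B : Str n} → Antichain B → (d : Sub D B) → Covers B D →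
    IsFull {C = D} {A = B} d
  antichain-full anti d cover =
    (λ b → maximal-inImage d cover (anti b)) ,
    (λ i x → maximal-reflected d cover (anti (proj₁ d x)) x refl i)

  addElem-sub : {C T : Str n} {w : Word} (ι : Sub C T) (t : Dom T) →
    ¬ InImage (proj₁ ι) t → w ≤w word T t → Sub (addElem C w) T
  addElem-sub {C} {T} {w} (ι , ι-injective , ι-hom) t fresh w≤t = κ , κ-injective , κ-hom
    where
      κ : Dom (addElem C w) → Dom T
      κ zero    = t
      κ (suc c) = ι c

      κ-injective : Injective _≡_ _≡_ κ
      κ-injective {zero}  {zero}   _     = refl
      κ-injective {zero}  {suc c}  t≡ιc  = ⊥-elim (fresh (c , sym t≡ιc))
      κ-injective {suc c} {zero}   ιc≡t  = ⊥-elim (fresh (c , ιc≡t))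
      κ-injective {suc c} {suc c′} ιc≡ιc′ = cong suc (ι-injective ιc≡ιc′)

      κ-hom : (i : Fin n) (x : Dom (addElem C w)) →
        rel (addElem C w) i x ≡ true → rel T i (κ x) ≡ true
      κ-hom i zero    = w≤t i
      κ-hom i (suc c) = ι-hom i c

  addElem-full : {C D : Str n} {w : Word} → Antichain C → ¬ (wAll C ≤w w) →
    (d : Sub D (addElem C w)) → Covers (addElem C w) D → wAll D ≤w w → w ≤w wAll D →
    IsFull {C = D} {A = addElem C w} d
  addElem-full {C} {D} {w} anti wAllC≰w d cover wAllD≤w w≤wAllD = onto , reflects
    where
      δ : Dom D → Dom (addElem C w)
      δ = proj₁ d

      maximal-suc : ∀ c → Maximal (addElem C w) (suc c)
      maximal-suc c zero     c≤w   = ⊥-elim (wAllC≰w (≤w-trans (wAll≤word C c) c≤w))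
      maximal-suc c (suc c′) c≤c′ = cong suc (anti c c′ c≤c′)

      wAllC≤ : ((x : Dom D) → ¬ δ x ≡ zero) → ∀ x → wAll C ≤w word D x
      wAllC≤ missed x with δ x in δx≡
      ... | zero  = ⊥-elim (missed x δx≡)
      ... | suc c = ≤w-trans (wAll≤word C c) (maximal-reflected d cover (maximal-suc c) x δx≡)

      zero-inImage : Dec (InImage δ zero) → InImage δ zero
      zero-inImage (yes hit) = hit
      zero-inImage (no miss) =
        ⊥-elim (wAllC≰w (≤w-trans (≤wAll D (wAllC≤ λ x δx≡0 → miss (x , δx≡0))) wAllD≤w))

      onto : ∀ b → InImage δ b
      onto zero    = zero-inImage (any? λ x → δ x ≟ᶠ zero)
      onto (suc c) = maximal-inImage d cover (maximal-suc c)

      reflects : (i : Fin n) (x : Dom D) → rel (addElem C w) i (δ x) ≡ true → rel D i x ≡ true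
      reflects i x with δ x in δx≡
      ... | zero  = λ h → wAll≤word D x i (w≤wAllD i h)
      ... | suc c = maximal-reflected d cover (maximal-suc c) x δx≡ i

  dropDominated : (C : Str n) (c c′ : Dom C) → ¬ c ≡ c′ → word C c ≤w word C c′ →
    Σ (Str n) λ D → Σ (Sub D C) λ d → Covers C D × ¬ (∀ x → InImage (proj₁ d) x)
  dropDominated record { card = ℕ.zero } zero zero c≢c′ _ = ⊥-elim (c≢c′ refl)
  dropDominated C@record { card = ℕ.suc m ; rel = r } c c′ c≢c′ c≤c′ =
    D , d , cover , λ onto → punchInᵢ≢i c _ (proj₂ (onto c))
    where
      D : Str n
      D = record { card = m ; rel = λ i → r i ∘ punchIn c }

      d : Sub D C
      d = punchIn c , (λ {x} {y} → punchIn-injective c x y) , λ i x h → h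

      cover : Covers C D
      cover x with c ≟ᶠ x
      ... | yes refl = punchOut c≢c′ ,
        subst (λ y → word C c ≤w word C y) (sym (punchIn-punchOut c≢c′)) c≤c′
      ... | no c≢x   = punchOut c≢x ,
        subst (λ y → word C x ≤w word C y) (sym (punchIn-punchOut c≢x)) ≤w-refl

  core-antichain : {A C : Str n} (e : Sub C A) → IsCore A C e → Antichain C
  core-antichain {A} {C} e (same , minimal) c c′ c≤c′ with c ≟ᶠ c′
  ... | yes c≡c′ = sym c≡c′
  ... | no c≢c′  =
    let (D , d , cover , notOnto) = dropDominated C c c′ c≢c′ c≤c′
        sameD : SameTheory false A D
        sameD = sameTheory-intro (covers-trans (sameTheory⇒covers same) cover)
                  (covers-trans (sub⇒covers d) (sub⇒covers e)) (λ ()) (λ ())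
    in ⊥-elim (notOnto (proj₁ (minimal D d sameD)))

  full⇒iso : {D Q : Str n} (d : Sub D Q) → IsFull {C = D} {A = Q} d → Iso Q D
  full⇒iso {D} {Q} (ι , ι-injective , ι-hom) (onto , reflects) =
    mk↔ₛ′ pre ι (λ x → ι-injective (ι∘pre (ι x))) ι∘pre , λ i q →
      ⇔→≡ (mk⇔ (reflects i (pre q) ∘ subst (λ y → rel Q i y ≡ true) (sym (ι∘pre q)))
               (subst (λ y → rel Q i y ≡ true) (ι∘pre q) ∘ ι-hom i (pre q)))
    where
      pre : Dom Q → Dom D
      pre q = proj₁ (onto q)

      ι∘pre : ∀ q → ι (pre q) ≡ q
      ι∘pre q = proj₂ (onto q)

  QMinimal : Str n → Str n → Set
  QMinimal A B = (D : Str n) (d : Sub D B) → SameTheory true A D → IsFull {C = D} {A = B} d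

  qcoreIs-intro : {A B : Str n} → ((T : Str n) → SameTheory true A T → Sub B T) →
    SameTheory true A B → QMinimal A B → QCoreIs A B
  qcoreIs-intro {A} {B} embeds sameB minimal =
    (B , embeds A sameTheory-refl , (sameB , minimal) , (↔-id (Dom B) , λ i b → refl)) ,
    λ Q _ (sameQ , minimalQ) → full⇒iso (embeds Q sameQ) (minimalQ B (embeds Q sameQ) sameB)

  module _ {A C : Str n} (anti : Antichain C) (coverAC : Covers A C) (coverCA : Covers C A) where

    antichain-embedsModel : (T : Str n) → SameTheory true A T → Sub C T
    antichain-embedsModel T st =
      antichain-embeds anti (covers-trans coverCA (sameTheory⇒covers st))
        (covers-trans (sameTheory⇒covers (sameTheory-sym st)) coverAC)

    qcoreIs-antichain : wAll C ≤w wAll A → QCoreIs A C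
    qcoreIs-antichain wAllC≤wAllA = qcoreIs-intro antichain-embedsModel sameC minimal
      where
        sameC : SameTheory true A C
        sameC = sameTheory-intro coverAC coverCA
                  (λ _ → antichain-wAll≥ anti coverCA coverAC) (λ _ → wAllC≤wAllA)

        minimal : QMinimal A C
        minimal D d st = antichain-full anti d (covers-trans coverCA (sameTheory⇒covers st))

    qcoreIs-addElem : ¬ (wAll C ≤w wAll A) → QCoreIs A (addElem C (wAll A))
    qcoreIs-addElem wAllC≰wAllA = qcoreIs-intro embeds sameB minimal
      where
        B : Str n
        B = addElem C (wAll A)

        embeds : (T : Str n) → SameTheory true A T → Sub B T
        embeds T st =
          let (t , fresh) = missedPoint (proj₁ ι) notOnto
          in addElem-sub {T = T} ι t fresh (≤w-trans (sameTheory⇒wAll≤ st) (wAll≤word T t))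
          where
            ι : Sub C T
            ι = antichain-embedsModel T st

            notOnto : ¬ (∀ t → InImage (proj₁ ι) t)
            notOnto onto =
              wAllC≰wAllA (≤w-trans (onto-sub⇒wAll≤ ι onto) (sameTheory⇒wAll≤ (sameTheory-sym st)))

        coverAB : Covers A B
        coverAB a = let (c , a≤c) = coverAC a in suc c , a≤c

        coverBA : Covers B A
        coverBA = sub⇒covers (embeds A sameTheory-refl)

        wAllA≤wAllB : wAll A ≤w wAll B
        wAllA≤wAllB = ≤wAll B λ
          { zero    → ≤w-refl
          ; (suc c) → ≤w-trans (antichain-wAll≥ anti coverCA coverAC) (wAll≤word C c)
          }

        sameB : SameTheory true A B
        sameB = sameTheory-intro coverAB coverBA (λ _ → wAllA≤wAllB) (λ _ → wAll≤word B zero)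

        minimal : QMinimal A B
        minimal D d st =
          addElem-full anti wAllC≰wAllA d (covers-trans coverBA (sameTheory⇒covers st))
            (sameTheory⇒wAll≤ (sameTheory-sym st)) (sameTheory⇒wAll≤ st)

mainTheorem9 : {n : ℕ} (A A' : Str n) (e : Sub A' A) → IsCore A A' e →
    (((i : Fin n) → wAll A' i ≡ wAll A i) → QCoreIs A A') ×
    (¬ ((i : Fin n) → wAll A' i ≡ wAll A i) → QCoreIs A (addElem A' (wAll A)))
mainTheorem9 A A' e core =
  (λ same → qcoreIs-antichain anti coverAA' coverA'A λ i → subst (_≡ true) (same i)) ,
  (λ differ → qcoreIs-addElem anti coverAA' coverA'A λ wAllA'≤wAllA →
     differ (≤w-antisym wAllA'≤wAllA (antichain-wAll≥ anti coverA'A coverAA')))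
  where
    anti : Antichain A'
    anti = core-antichain e core

    coverAA' : Covers A A'
    coverAA' = sameTheory⇒covers (proj₁ core)

    coverA'A : Covers A' A
    coverA'A = sub⇒covers e
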